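{- Let $\lambda$ be a nonzero real number. For every integer $n\ge 0$, $$\sum_{j=0}^{n}\sum_{l=0}^{j}\binom{n}{j}(1)_{n-j,\lambda}(-1)^{l}d_{l,\lambda}(x)S_{2,\lambda}(j,l)=\sum_{j=0}^{n}(x-1)_{j,\lambda}(-1)^{j}S_{2,\lambda}(n,j).$$
   Context: For a nonzero real $\lambda$, the degenerate falling factorial is $(x)_{0,\lambda}=1$ and $(x)_{n,\lambda}=x(x-\lambda)\cdots(x-(n-1)\lambda)$ for $n\ge1$. The degenerate exponential function is $e_{\lambda}^{x}(t)=(1+\lambda t)^{x/\lambda}=\sum_{n\ge0}(x)_{n,\lambda}\frac{t^n}{n!}$, and $e_\lambda(t)=e_\lambda^1(t)$. The degenerate derangement polynomials $d_{n,\lambda}(x)$ are defined by $\frac{1}{1-t}e_{\lambda}^{x-1}(t)=\sum_{n\ge0}d_{n,\lambda}(x)\frac{t^n}{n!}$. The degenerate Stirling numbers of the second kind $S_{2,\lambda}(n,m)$ are defined by $\frac{1}{m!}(e_{\lambda}(t)-1)^m=\sum_{n\ge m}S_{2,\lambda}(n,m)\frac{t^n}{n!}$ for $m\ge0$ (equivalently $(x)_{n,\lambda}=\sum_{l=0}^n S_{2,\lambda}(n,l)(x)_l$ with $(x)_l$ the ordinary falling factorial), with $S_{2,\lambda}(n,m)=0$ for $m>n$.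
   Formalization: The nonzero parameter λ is rational rather than real, and the variable x also ranges over the rationals. -}

module Defs where

open import Data.Nat as ℕ using (ℕ; zero; suc; _∸_; _!)
open import Data.Nat.Properties using (_!≢0)
open import Data.Nat.Combinatorics using (_C_)
open import Data.Integer using (+_)
open import Data.Rational using (ℚ; 0ℚ; 1ℚ; _+_; _*_; _-_; -_; _/_)

ℕ→ℚ : ℕ → ℚ
ℕ→ℚ n = (+ n) / 1

inv! : ℕ → ℚ
inv! n = ((+ 1) / (n !)) {{n !≢0}}

sumTo : ℕ → (ℕ → ℚ) → ℚ
sumTo zero    f = f 0
sumTo (suc n) f = sumTo n f + f (suc n)

sgn : ℕ → ℚ
sgn zero    = 1ℚ
sgn (suc n) = - sgn n

-- degenerate falling factorial (x)_{n,λ} = x (x - λ) ⋯ (x - (n-1) λ)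
dff : ℚ → ℚ → ℕ → ℚ
dff lam x zero    = 1ℚ
dff lam x (suc n) = dff lam x n * (x - ℕ→ℚ n * lam)

Series : Set
Series = ℕ → ℚ

_⋆_ : Series → Series → Series
(f ⋆ g) n = sumTo n (λ k → f k * g (n ∸ k))

pow : Series → ℕ → Series
pow f zero    zero    = 1ℚ
pow f zero    (suc n) = 0ℚ
pow f (suc m)         = f ⋆ pow f m

-- e_λ^x(t) = Σ (x)_{n,λ} t^n / n!
eλ^ : ℚ → ℚ → Series
eλ^ lam x n = dff lam x n * inv! n

geom : Series
geom n = 1ℚ

eλ-1 : ℚ → Series
eλ-1 lam zero    = 0ℚ
eλ-1 lam (suc n) = eλ^ lam 1ℚ (suc n)

-- degenerate derangement polynomial: 1/(1-t) e_λ^{x-1}(t) = Σ d_{n,λ}(x) t^n/n!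
derange : ℚ → ℚ → ℕ → ℚ
derange lam x n = ℕ→ℚ (n !) * (geom ⋆ eλ^ lam (x - 1ℚ)) n

-- degenerate Stirling numbers of the 2nd kind:
-- (1/m!) (e_λ(t) - 1)^m = Σ_{n} S_{2,λ}(n,m) t^n/n!
S2 : ℚ → ℕ → ℕ → ℚ
S2 lam n m = ℕ→ℚ (n !) * (inv! m * pow (eλ-1 lam) m n)

binom : ℕ → ℕ → ℚ
binom n k = ℕ→ℚ (n C k)

module Submission where

open import Defs
open import Data.Nat using (ℕ; _∸_)
open import Data.Rational using (ℚ; 0ℚ; 1ℚ; _*_; _-_)
open import Relation.Binary.PropositionalEquality using (_≡_; _≢_)

open import Data.Nat as ℕ using (zero; suc; _≤_; _<_; z≤n; s≤s; _!)
import Data.Nat.Properties as ℕ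
open import Data.Nat.Combinatorics using (_C_; nCk≡n!/k![n-k]!; k![n∸k]!∣n!)
open import Data.Nat.DivMod using (m/n*n≡m)
open import Data.Integer as ℤ using (+_)
open import Data.Integer.Properties using (pos-*)
open import Data.Rational using (_+_; _/_; toℚᵘ)
open import Data.Rational.Properties
import Data.Rational.Unnormalised as ℚᵘ
import Data.Rational.Unnormalised.Properties as ℚᵘ
open import Data.Rational.Solver using (module +-*-Solver)
open import Data.Sum using (inj₁; inj₂)
open import Relation.Binary.PropositionalEquality using (refl; sym; trans; cong; cong₂; module ≡-Reasoning)
open +-*-Solver using (solve; con; _:+_; _:*_; :-_; _:=_)

-- Write E = e_λ(t) = 1 + U with U = e_λ(t) - 1. Divided by n!, the left-hand side is
-- the coefficient of t^n in  Σ_l a_l U^l (1 + U) = Σ_l a_l (U^l + U^{l+1}),  where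
-- a_l = (-1)^l d_{l,λ}(x)/l! = (-1)^l Σ_{k≤l} (x-1)_{k,λ}/k!  are alternating partial sums.
-- Summation by parts collects the coefficient of U^l as a_l + a_{l-1} = (-1)^l (x-1)_{l,λ}/l!,
-- and U^{n+1} has no t^n term, so what remains is the right-hand side divided by n!.

ℕ→ℚ-homo-* : ∀ m n → ℕ→ℚ (m ℕ.* n) ≡ ℕ→ℚ m * ℕ→ℚ n
ℕ→ℚ-homo-* m n = toℚᵘ-injective (begin-≃
  toℚᵘ (ℕ→ℚ (m ℕ.* n))                ≈⟨ toℚᵘ-fromℚᵘ (ℚᵘ.mkℚᵘ (+ (m ℕ.* n)) 0) ⟩
  ℚᵘ.mkℚᵘ (+ (m ℕ.* n)) 0              ≡⟨ cong (λ i → ℚᵘ.mkℚᵘ i 0) (pos-* m n) ⟩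
  ℚᵘ.mkℚᵘ (+ m ℤ.* + n) 0              ≈⟨ ℚᵘ.*-cong (toℚᵘ-fromℚᵘ (ℚᵘ.mkℚᵘ (+ m) 0)) (toℚᵘ-fromℚᵘ (ℚᵘ.mkℚᵘ (+ n) 0)) ⟨
  toℚᵘ (ℕ→ℚ m) ℚᵘ.* toℚᵘ (ℕ→ℚ n)       ≈⟨ toℚᵘ-homo-* (ℕ→ℚ m) (ℕ→ℚ n) ⟨
  toℚᵘ (ℕ→ℚ m * ℕ→ℚ n)                 ∎)
  where open ℚᵘ.≃-Reasoning renaming (begin_ to begin-≃_)

ℕ→ℚ*1/≡1 : ∀ d .{{_ : ℕ.NonZero d}} → ℕ→ℚ d * ((+ 1) / d) ≡ 1ℚ
ℕ→ℚ*1/≡1 (suc k) = toℚᵘ-injective (ℚᵘ.≃-trans (toℚᵘ-homo-* (ℕ→ℚ (suc k)) ((+ 1) / suc k))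
  (ℚᵘ.≃-trans (ℚᵘ.*-cong (toℚᵘ-fromℚᵘ (ℚᵘ.mkℚᵘ (+ suc k) 0)) (toℚᵘ-fromℚᵘ (ℚᵘ.mkℚᵘ (+ 1) k)))
              (ℚᵘ.*-inverseʳ (ℚᵘ.mkℚᵘ (+ suc k) 0))))

n!*inv!≡1 : ∀ n → ℕ→ℚ (n !) * inv! n ≡ 1ℚ
n!*inv!≡1 n = ℕ→ℚ*1/≡1 (n !) {{n ℕ.!≢0}}

open ≡-Reasoning

binom*k!≡n!*inv![n∸k] : ∀ {n k} → k ≤ n → binom n k * ℕ→ℚ (k !) ≡ ℕ→ℚ (n !) * inv! (n ∸ k)
binom*k!≡n!*inv![n∸k] {n} {k} k≤n = begin
  c * k!                                 ≡⟨ *-identityʳ _ ⟨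
  c * k! * 1ℚ                            ≡⟨ cong (c * k! *_) (n!*inv!≡1 (n ∸ k)) ⟨
  c * k! * ([n∸k]! * inv! (n ∸ k))       ≡⟨ solve 4 (λ c a b i → c :* a :* (b :* i) := c :* (a :* b) :* i)
                                              refl c k! [n∸k]! (inv! (n ∸ k)) ⟩
  c * (k! * [n∸k]!) * inv! (n ∸ k)       ≡⟨ cong (λ q → c * q * inv! (n ∸ k)) (ℕ→ℚ-homo-* (k !) ((n ∸ k) !)) ⟨
  c * ℕ→ℚ (k ! ℕ.* (n ∸ k) !) * inv! (n ∸ k)
    ≡⟨ cong (_* inv! (n ∸ k)) (ℕ→ℚ-homo-* (n C k) _) ⟨
  ℕ→ℚ ((n C k) ℕ.* (k ! ℕ.* (n ∸ k) !)) * inv! (n ∸ k)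
    ≡⟨ cong (λ m → ℕ→ℚ m * inv! (n ∸ k)) nCk*k![n∸k]!≡n! ⟩
  ℕ→ℚ (n !) * inv! (n ∸ k)               ∎
  where
  c k! [n∸k]! : ℚ
  c      = binom n k
  k!     = ℕ→ℚ (k !)
  [n∸k]! = ℕ→ℚ ((n ∸ k) !)

  instance
    k![n∸k]!≢0 : ℕ.NonZero (k ! ℕ.* (n ∸ k) !)
    k![n∸k]!≢0 = ℕ.m*n≢0 (k !) ((n ∸ k) !) {{k ℕ.!≢0}} {{(n ∸ k) ℕ.!≢0}}

  nCk*k![n∸k]!≡n! : (n C k) ℕ.* (k ! ℕ.* (n ∸ k) !) ≡ n !
  nCk*k![n∸k]!≡n! = trans (cong (ℕ._* (k ! ℕ.* (n ∸ k) !)) (nCk≡n!/k![n-k]! k≤n)) (m/n*n≡m (k![n∸k]!∣n! k≤n))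

sumTo-cong : ∀ n {f g : ℕ → ℚ} → (∀ k → k ≤ n → f k ≡ g k) → sumTo n f ≡ sumTo n g
sumTo-cong zero    f≡g = f≡g 0 z≤n
sumTo-cong (suc n) f≡g = cong₂ _+_ (sumTo-cong n (λ k k≤n → f≡g k (ℕ.m≤n⇒m≤1+n k≤n))) (f≡g (suc n) ℕ.≤-refl)

sumTo-zero : ∀ n {f : ℕ → ℚ} → (∀ k → k ≤ n → f k ≡ 0ℚ) → sumTo n f ≡ 0ℚ
sumTo-zero zero    f≡0 = f≡0 0 z≤n
sumTo-zero (suc n) f≡0 = cong₂ _+_ (sumTo-zero n (λ k k≤n → f≡0 k (ℕ.m≤n⇒m≤1+n k≤n))) (f≡0 (suc n) ℕ.≤-refl)

sumTo-+ : ∀ n (f g : ℕ → ℚ) → sumTo n (λ k → f k + g k) ≡ sumTo n f + sumTo n g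
sumTo-+ zero    f g = refl
sumTo-+ (suc n) f g = trans (cong (_+ (f (suc n) + g (suc n))) (sumTo-+ n f g))
  (solve 4 (λ a b c d → (a :+ b) :+ (c :+ d) := (a :+ c) :+ (b :+ d)) refl
     (sumTo n f) (sumTo n g) (f (suc n)) (g (suc n)))

sumTo-*ˡ : ∀ n c (f : ℕ → ℚ) → sumTo n (λ k → c * f k) ≡ c * sumTo n f
sumTo-*ˡ zero    c f = refl
sumTo-*ˡ (suc n) c f = trans (cong (_+ (c * f (suc n))) (sumTo-*ˡ n c f)) (sym (*-distribˡ-+ c _ _))

sumTo-suc-head : ∀ n (f : ℕ → ℚ) → sumTo (suc n) f ≡ f 0 + sumTo n (λ k → f (suc k))
sumTo-suc-head zero    f = refl
sumTo-suc-head (suc n) f = trans (cong (_+ f (suc (suc n))) (sumTo-suc-head n f)) (+-assoc (f 0) _ _)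

sumTo-reverse : ∀ n (f : ℕ → ℚ) → sumTo n f ≡ sumTo n (λ k → f (n ∸ k))
sumTo-reverse zero    f = refl
sumTo-reverse (suc n) f = begin
  sumTo n f + f (suc n)                   ≡⟨ cong (_+ f (suc n)) (sumTo-reverse n f) ⟩
  sumTo n (λ k → f (n ∸ k)) + f (suc n)   ≡⟨ +-comm _ (f (suc n)) ⟩
  f (suc n) + sumTo n (λ k → f (n ∸ k))   ≡⟨ sumTo-suc-head n (λ k → f (suc n ∸ k)) ⟨
  sumTo (suc n) (λ k → f (suc n ∸ k))     ∎

sumTo-swap : ∀ m n (h : ℕ → ℕ → ℚ) → sumTo m (λ j → sumTo n (h j)) ≡ sumTo n (λ l → sumTo m (λ j → h j l))
sumTo-swap zero    n h = refl
sumTo-swap (suc m) n h = trans (cong (_+ sumTo n (h (suc m))) (sumTo-swap m n h))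
  (sym (sumTo-+ n (λ l → sumTo m (λ j → h j l)) (h (suc m))))

sumTo-extend : ∀ {m} n (f : ℕ → ℚ) → m ≤ n → (∀ k → m < k → k ≤ n → f k ≡ 0ℚ) → sumTo m f ≡ sumTo n f
sumTo-extend zero    f z≤n tail≡0 = refl
sumTo-extend {m} (suc n) f m≤1+n tail≡0 with ℕ.m≤n⇒m<n∨m≡n m≤1+n
... | inj₂ refl       = refl
... | inj₁ (s≤s m≤n) = begin
  sumTo m f             ≡⟨ sumTo-extend n f m≤n (λ k m<k k≤n → tail≡0 k m<k (ℕ.m≤n⇒m≤1+n k≤n)) ⟩
  sumTo n f             ≡⟨ +-identityʳ _ ⟨
  sumTo n f + 0ℚ        ≡⟨ cong (λ z → sumTo n f + z) (tail≡0 (suc n) (s≤s m≤n) ℕ.≤-refl) ⟨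
  sumTo n f + f (suc n) ∎

withPrevious : (ℕ → ℚ) → ℕ → ℚ
withPrevious a zero    = a 0
withPrevious a (suc l) = a (suc l) + a l

summation-by-parts : ∀ n (a b : ℕ → ℚ) →
  sumTo n (λ l → a l * (b l + b (suc l))) ≡ sumTo n (λ l → withPrevious a l * b l) + a n * b (suc n)
summation-by-parts zero    a b = *-distribˡ-+ (a 0) (b 0) (b 1)
summation-by-parts (suc n) a b =
  trans (cong (_+ a (suc n) * (b (suc n) + b (suc (suc n)))) (summation-by-parts n a b))
    (solve 5 (λ s aₙ a₁ b₁ b₂ → (s :+ aₙ :* b₁) :+ a₁ :* (b₁ :+ b₂) := (s :+ (a₁ :+ aₙ) :* b₁) :+ a₁ :* b₂)
       refl (sumTo n (λ l → withPrevious a l * b l)) (a n) (a (suc n)) (b (suc n)) (b (suc (suc n))))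

withPrevious-alternating-partialSums : ∀ (f : ℕ → ℚ) l → withPrevious (λ k → sgn k * sumTo k f) l ≡ sgn l * f l
withPrevious-alternating-partialSums f zero    = refl
withPrevious-alternating-partialSums f (suc l) =
  solve 3 (λ s S x → (:- s) :* (S :+ x) :+ s :* S := (:- s) :* x) refl (sgn l) (sumTo l f) (f (suc l))

one : Series
one zero    = 1ℚ
one (suc _) = 0ℚ

_⊕_ : Series → Series → Series
(f ⊕ g) n = f n + g n

⋆-congʳ : ∀ f {g h : Series} → (∀ k → g k ≡ h k) → ∀ n → (f ⋆ g) n ≡ (f ⋆ h) n
⋆-congʳ f g≡h n = sumTo-cong n (λ k _ → cong (f k *_) (g≡h (n ∸ k)))

⋆-comm : ∀ (f g : Series) n → (f ⋆ g) n ≡ (g ⋆ f) n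
⋆-comm f g n = trans (sumTo-reverse n (λ k → f k * g (n ∸ k)))
  (sumTo-cong n (λ k k≤n → trans (cong (λ i → f (n ∸ k) * g i) (ℕ.m∸[m∸n]≡n k≤n)) (*-comm (f (n ∸ k)) (g k))))

⋆-identityʳ : ∀ (f : Series) n → (f ⋆ one) n ≡ f n
⋆-identityʳ f zero    = *-identityʳ (f 0)
⋆-identityʳ f (suc n) = begin
  sumTo n (λ k → f k * one (suc n ∸ k)) + f (suc n) * one (n ∸ n)
    ≡⟨ cong₂ _+_ (sumTo-zero n (λ k k≤n → trans (cong (λ i → f k * one i) (ℕ.+-∸-assoc 1 k≤n)) (*-zeroʳ (f k))))
                 (trans (cong (λ i → f (suc n) * one i) (ℕ.n∸n≡0 n)) (*-identityʳ (f (suc n)))) ⟩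
  0ℚ + f (suc n) ≡⟨ +-identityˡ _ ⟩
  f (suc n)      ∎

⋆-distribˡ-⊕ : ∀ (f g h : Series) n → (f ⋆ (g ⊕ h)) n ≡ (f ⋆ g) n + (f ⋆ h) n
⋆-distribˡ-⊕ f g h n = trans (sumTo-cong n (λ k _ → *-distribˡ-+ (f k) (g (n ∸ k)) (h (n ∸ k))))
  (sumTo-+ n (λ k → f k * g (n ∸ k)) (λ k → f k * h (n ∸ k)))

geom⋆f≡partialSum : ∀ (f : Series) n → (geom ⋆ f) n ≡ sumTo n f
geom⋆f≡partialSum f n = trans (sumTo-cong n (λ k _ → *-identityˡ (f (n ∸ k)))) (sym (sumTo-reverse n f))

pow-vanishes-below : ∀ (f : Series) → f 0 ≡ 0ℚ → ∀ {m j} → j < m → pow f m j ≡ 0ℚ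
pow-vanishes-below f f₀≡0 {suc m} {j} (s≤s j≤m) = sumTo-zero j term≡0
  where
  term≡0 : ∀ k → k ≤ j → f k * pow f m (j ∸ k) ≡ 0ℚ
  term≡0 zero    _     = trans (cong (_* pow f m j) f₀≡0) (*-zeroˡ (pow f m j))
  term≡0 (suc k) 1+k≤j = trans (cong (f (suc k) *_) (pow-vanishes-below f f₀≡0 j∸[1+k]<m)) (*-zeroʳ (f (suc k)))
    where
    j∸[1+k]<m : j ∸ suc k < m
    j∸[1+k]<m = ℕ.<-≤-trans (ℕ.∸-monoʳ-< ℕ.z<s 1+k≤j) j≤m

pow⋆one⊕≡pow+pow-suc : ∀ (U : Series) l n → (pow U l ⋆ (one ⊕ U)) n ≡ pow U l n + pow U (suc l) n
pow⋆one⊕≡pow+pow-suc U l n = trans (⋆-distribˡ-⊕ (pow U l) one U n)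
  (cong₂ _+_ (⋆-identityʳ (pow U l) n) (⋆-comm (pow U l) U n))

alternating-partialSums-expansion :
  ∀ (U : Series) → U 0 ≡ 0ℚ → ∀ (E : Series) → (∀ k → E k ≡ (one ⊕ U) k) → ∀ (f : Series) n →
  sumTo n (λ j → sumTo j (λ l → sgn l * sumTo l f * (pow U l j * E (n ∸ j))))
    ≡ sumTo n (λ j → sgn j * f j * pow U j n)
alternating-partialSums-expansion U U₀≡0 E E≡one⊕U f n = begin
  sumTo n (λ j → sumTo j (term j))
    ≡⟨ sumTo-cong n (λ j j≤n → sumTo-extend n (term j) j≤n (λ l j<l _ → term≡0 j<l)) ⟩
  sumTo n (λ j → sumTo n (term j))
    ≡⟨ sumTo-swap n n term ⟩
  sumTo n (λ l → sumTo n (λ j → term j l))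
    ≡⟨ sumTo-cong n (λ l _ → sum-over-j l) ⟩
  sumTo n (λ l → a l * (pow U l n + pow U (suc l) n))
    ≡⟨ summation-by-parts n a (λ l → pow U l n) ⟩
  sumTo n (λ l → withPrevious a l * pow U l n) + a n * pow U (suc n) n
    ≡⟨ cong₂ _+_ (sumTo-cong n (λ l _ → cong (_* pow U l n) (withPrevious-alternating-partialSums f l)))
                 (trans (cong (a n *_) (pow-vanishes-below U U₀≡0 {suc n} {n} ℕ.≤-refl)) (*-zeroʳ (a n))) ⟩
  sumTo n (λ l → sgn l * f l * pow U l n) + 0ℚ
    ≡⟨ +-identityʳ _ ⟩
  sumTo n (λ l → sgn l * f l * pow U l n) ∎
  where
  a : ℕ → ℚ
  a l = sgn l * sumTo l f

  term : ℕ → ℕ → ℚ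
  term j l = a l * (pow U l j * E (n ∸ j))

  term≡0 : ∀ {j l} → j < l → term j l ≡ 0ℚ
  term≡0 {j} {l} j<l = begin
    a l * (pow U l j * E (n ∸ j)) ≡⟨ cong (λ p → a l * (p * E (n ∸ j))) (pow-vanishes-below U U₀≡0 j<l) ⟩
    a l * (0ℚ * E (n ∸ j))        ≡⟨ cong (a l *_) (*-zeroˡ (E (n ∸ j))) ⟩
    a l * 0ℚ                      ≡⟨ *-zeroʳ (a l) ⟩
    0ℚ                            ∎

  sum-over-j : ∀ l → sumTo n (λ j → term j l) ≡ a l * (pow U l n + pow U (suc l) n)
  sum-over-j l = begin
    sumTo n (λ j → term j l)      ≡⟨ sumTo-*ˡ n (a l) (λ j → pow U l j * E (n ∸ j)) ⟩
    a l * (pow U l ⋆ E) n         ≡⟨ cong (a l *_) (⋆-congʳ (pow U l) E≡one⊕U n) ⟩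
    a l * (pow U l ⋆ (one ⊕ U)) n ≡⟨ cong (a l *_) (pow⋆one⊕≡pow+pow-suc U l n) ⟩
    a l * (pow U l n + pow U (suc l) n) ∎

eλ^1≡one⊕eλ-1 : ∀ lam k → eλ^ lam 1ℚ k ≡ (one ⊕ eλ-1 lam) k
eλ^1≡one⊕eλ-1 lam zero    = refl
eλ^1≡one⊕eλ-1 lam (suc k) = sym (+-identityˡ (eλ^ lam 1ℚ (suc k)))

derange≡l!*partialSum : ∀ lam x l → derange lam x l ≡ ℕ→ℚ (l !) * sumTo l (eλ^ lam (x - 1ℚ))
derange≡l!*partialSum lam x l = cong (ℕ→ℚ (l !) *_) (geom⋆f≡partialSum (eλ^ lam (x - 1ℚ)) l)

module _ (lam x : ℚ) where

  lhs-summand : ∀ {n j} l → j ≤ n →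
    binom n j * dff lam 1ℚ (n ∸ j) * sgn l * derange lam x l * S2 lam j l
      ≡ ℕ→ℚ (n !) * (sgn l * sumTo l (eλ^ lam (x - 1ℚ)) * (pow (eλ-1 lam) l j * eλ^ lam 1ℚ (n ∸ j)))
  lhs-summand {n} {j} l j≤n = begin
    binom n j * d * s * derange lam x l * (j! * (inv! l * p))
      ≡⟨ cong (λ q → binom n j * d * s * q * (j! * (inv! l * p))) (derange≡l!*partialSum lam x l) ⟩
    binom n j * d * s * (l! * A) * (j! * (inv! l * p))
      ≡⟨ solve 8 (λ c d s l! A j! i p → c :* d :* s :* (l! :* A) :* (j! :* (i :* p))
                                        := c :* j! :* (l! :* i) :* (s :* A :* (p :* d)))
           refl (binom n j) d s l! A j! (inv! l) p ⟩
    binom n j * j! * (l! * inv! l) * (s * A * (p * d))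
      ≡⟨ cong₂ (λ u v → u * v * (s * A * (p * d))) (binom*k!≡n!*inv![n∸k] j≤n) (n!*inv!≡1 l) ⟩
    ℕ→ℚ (n !) * inv! (n ∸ j) * 1ℚ * (s * A * (p * d))
      ≡⟨ solve 6 (λ n! i s A p d → n! :* i :* con 1ℚ :* (s :* A :* (p :* d)) := n! :* (s :* A :* (p :* (d :* i))))
           refl (ℕ→ℚ (n !)) (inv! (n ∸ j)) s A p d ⟩
    ℕ→ℚ (n !) * (s * A * (p * (d * inv! (n ∸ j)))) ∎
    where
    d s l! j! A p : ℚ
    d  = dff lam 1ℚ (n ∸ j)
    s  = sgn l
    l! = ℕ→ℚ (l !)
    j! = ℕ→ℚ (j !)
    A  = sumTo l (eλ^ lam (x - 1ℚ))
    p  = pow (eλ-1 lam) l j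

  rhs-summand : ∀ n j →
    dff lam (x - 1ℚ) j * sgn j * S2 lam n j ≡ ℕ→ℚ (n !) * (sgn j * eλ^ lam (x - 1ℚ) j * pow (eλ-1 lam) j n)
  rhs-summand n j = solve 5 (λ y s n! i p → y :* s :* (n! :* (i :* p)) := n! :* (s :* (y :* i) :* p))
    refl (dff lam (x - 1ℚ) j) (sgn j) (ℕ→ℚ (n !)) (inv! j) (pow (eλ-1 lam) j n)

theorem3 : (lam : ℚ) → lam ≢ 0ℚ → (x : ℚ) → (n : ℕ) →
    sumTo n (λ j → sumTo j (λ l →
      binom n j * dff lam 1ℚ (n ∸ j) * sgn l * derange lam x l * S2 lam j l))
    ≡ sumTo n (λ j → dff lam (x - 1ℚ) j * sgn j * S2 lam n j)
theorem3 lam _ x n = begin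
  sumTo n (λ j → sumTo j (λ l → binom n j * dff lam 1ℚ (n ∸ j) * sgn l * derange lam x l * S2 lam j l))
    ≡⟨ sumTo-cong n (λ j j≤n → trans (sumTo-cong j (λ l _ → lhs-summand lam x l j≤n)) (sumTo-*ˡ j n! _)) ⟩
  sumTo n (λ j → n! * sumTo j (λ l → sgn l * sumTo l F * (pow U l j * E (n ∸ j))))
    ≡⟨ sumTo-*ˡ n n! _ ⟩
  n! * sumTo n (λ j → sumTo j (λ l → sgn l * sumTo l F * (pow U l j * E (n ∸ j))))
    ≡⟨ cong (n! *_) (alternating-partialSums-expansion U refl E (eλ^1≡one⊕eλ-1 lam) F n) ⟩
  n! * sumTo n (λ j → sgn j * F j * pow U j n)
    ≡⟨ sumTo-*ˡ n n! _ ⟨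
  sumTo n (λ j → n! * (sgn j * F j * pow U j n))
    ≡⟨ sumTo-cong n (λ j _ → rhs-summand lam x n j) ⟨
  sumTo n (λ j → dff lam (x - 1ℚ) j * sgn j * S2 lam n j) ∎
  where
  n! : ℚ
  n! = ℕ→ℚ (n !)
  U E F : Series
  U = eλ-1 lam
  E = eλ^ lam 1ℚ
  F = eλ^ lam (x - 1ℚ)
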